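{- Let $f_1:Z_0\to Z_1$ and $f_2:Z_0\to Z_2$ be composable open net embeddings and let $Z_3=Z_1+_{f_1,f_2}Z_2$ with $\alpha_1:Z_1\to Z_3$, $\alpha_2:Z_2\to Z_3$. Let $u_1\xrightarrow{A_1}v_1$ and $u_2\xrightarrow{A_2}v_2$ be steps in $Z_1$ and $Z_2$ respectively, such that $u_1|_{f_1}=u_2|_{f_2}$ and $A_2=f_2^\oplus(A_1{\downarrow_{f_1}})$ (in particular the right-hand side is defined). Then $v_1|_{f_1}=v_2|_{f_2}$ and, setting $A_3=\alpha_1^\oplus(A_1)$, there is a step $u_1\uplus u_2\xrightarrow{A_3}v_1\uplus v_2$ in $Z_3$.
   Context: Multisets: $X^\oplus$ is the set of finite multisets over $X$ (sum $\oplus$, empty $0$, multiplicity $u(x)$). For $h:X\to Y$, $h^\oplus$ is its monoidal extension and $h$ acts on subsets elementwise; for $f:X\to Y$ and $u\in Y^\oplus$, $(u|_f)(x)=u(f(x))$. Nets: a P/T net $N=(S,T,\sigma,\tau,\lambda)$ over label set $\Lambda$: places $S$, transitions $T$, pre/post-sets $\sigma,\tau:T\to S^\oplus$ (written ${}^\bullet t$, $t^\bullet$), labelling $\lambda$; ${}^\bullet s=\{t: s\in t^\bullet\}$, $s^\bullet=\{t: s\in {}^\bullet t\}$. Net morphisms $f=\langle f_T,f_S\rangle$ satisfy ${}^\bullet f(t)=f^\oplus({}^\bullet t)$, $f(t)^\bullet=f^\oplus(t^\bullet)$ and preserve labels. An open net $Z$: a P/T net $(S_Z,T_Z,\sigma_Z,\tau_Z,\lambda_Z)$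 with input open places $O_Z^+$, output open places $O_Z^-$ ($\subseteq S_Z$), initial marking $u^0_Z\in S_Z^\oplus$. An open net morphism $f:Z_1\to Z_2$ is a net morphism with $f^{ -1}(O_{Z_2}^+)\cup\mathrm{in}(f)\subseteq O_{Z_1}^+$, $f^{ -1}(O_{Z_2}^-)\cup\mathrm{out}(f)\subseteq O_{Z_1}^-$, $u^0_{Z_1}=u^0_{Z_2}|_{f_S}$, where $\mathrm{in}(f)=\{s: {}^\bullet f(s)\setminus f({}^\bullet s)\ne\emptyset\}$, $\mathrm{out}(f)=\{s: f(s)^\bullet\setminus f(s^\bullet)\ne\emptyset\}$. Embedding: both components injective. Extended events: $\bar T_Z=T_Z\cup\{+_s: s\in O_Z^+\}\cup\{ -_s: s\in O_Z^-\}$, ${}^\bullet(+_s)=0$, $(+_s)^\bullet=s$, ${}^\bullet(-_s)=s$, $(-_s)^\bullet=0$, extended monoidally; $+_u=\bigoplus_s u(s)\cdot+_s$, similarly $-_u$. A step of $Z$ is $u\oplus{}^\bullet A\xrightarrow{A}u\oplus A^\bullet$ with $u\in S_Z^\oplus$, $A\in\bar T_Z^\oplus$. For an open net morphism $f:Z_1\to Z_2$, $f^\oplus$ on $\bar T_{Z_1}^\oplus$ is the partial monoidal map with $f^\oplus(t)=f(t)$ and $f^\oplus(x_s)=x_{f(s)}$ if $f(s)\in O_{Z_2}^x$, undefined otherwise ($x\in\{+,-\}$). Projection along an embedding $f:Z\to Z'$: $A'{\downarrow_f}\in\bar T_Z^\oplus$ is the monoidal extension of $t'{\downarrow_f}=t$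 if $t'=f(t)$, $t'{\downarrow_f}=-_{({}^\bullet t')|_f}\oplus+_{(t'^\bullet)|_f}$ if $t'\notin f(T_Z)$, $(x_{s'}){\downarrow_f}=x_{s'|_f}$. Composition: embeddings $f_1:Z_0\to Z_1$, $f_2:Z_0\to Z_2$ are composable if $f_2(\mathrm{in}(f_1))\subseteq O_{Z_2}^+$, $f_2(\mathrm{out}(f_1))\subseteq O_{Z_2}^-$, $f_1(\mathrm{in}(f_2))\subseteq O_{Z_1}^+$, $f_1(\mathrm{out}(f_2))\subseteq O_{Z_1}^-$. Then $Z_3=Z_1+_{f_1,f_2}Z_2$ is the open net whose place and transition sets are the pushouts in sets of $S_{Z_1}\leftarrow S_{Z_0}\rightarrow S_{Z_2}$ and $T_{Z_1}\leftarrow T_{Z_0}\rightarrow T_{Z_2}$ with canonical injections $\alpha_1,\alpha_2$, with ${}^\bullet\alpha_i(t)=\alpha_i^\oplus({}^\bullet t)$, $\alpha_i(t)^\bullet=\alpha_i^\oplus(t^\bullet)$, $\lambda_{Z_3}(\alpha_i(t))=\lambda_{Z_i}(t)$, $O_{Z_3}^x=\{s: \alpha_1^{ -1}(s)\subseteq O_{Z_1}^x\wedge\alpha_2^{ -1}(s)\subseteq O_{Z_2}^x\}$, and initial marking the unique $u$ with $u|_{\alpha_i}=u^0_{Z_i}$; $\alpha_1,\alpha_2$ are open net embeddings. For $u_1\in S_{Z_1}^\oplus$, $u_2\in S_{Z_2}^\oplus$ with $u_1|_{f_1}=u_2|_{f_2}$, $u_1\uplus u_2$ denotes the unique $u_3\in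 S_{Z_3}^\oplus$ with $u_3|_{\alpha_1}=u_1$, $u_3|_{\alpha_2}=u_2$. -}

module Defs where

open import Data.Empty using (⊥)
open import Data.Unit using (⊤)
open import Data.Product using (Σ; ∃; _×_; _,_)
open import Data.Sum using (_⊎_)
open import Data.List using (List; []; _∷_; _++_; map; concatMap; concat; [_])
open import Data.List.Membership.Propositional using (_∈_)
open import Data.List.Relation.Unary.All using (All)
open import Data.List.Relation.Binary.Pointwise using (Pointwise)
open import Data.List.Relation.Binary.BagAndSetEquality using (bag; _∼[_]_)
open import Function.Bundles using (_↔_)
open import Function.Definitions using (Injective)
open import Relation.Binary.PropositionalEquality using (_≡_; _≢_)
open import Relation.Nullary using (¬_)

-- Finite multisets over X are represented by lists, up to bag equality.
-- The multiplicity of x in u is the number of positions of x in u; the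
-- type (x ∈ u) of such positions has exactly u(x) elements.  Hence
-- "u(x) = v(y)" is rendered as a bijection (x ∈ u) ↔ (y ∈ v).

_≋_ : {X : Set} → List X → List X → Set
u ≋ v = u ∼[ bag ] v

-- u|_f = v|_g  (u ∈ Y^⊕, v ∈ Y'^⊕, f : X → Y, g : X → Y'):
-- for all x, u(f x) = v(g x).
RestrEq : {X Y Y' : Set} → (X → Y) → List Y → (X → Y') → List Y' → Set
RestrEq {X} f u g v = (x : X) → (f x ∈ u) ↔ (g x ∈ v)

record OpenNet (Λ : Set) : Set₁ where
  field
    S    : Set
    T    : Set
    pre  : T → List S
    post : T → List S
    lab  : T → Λ
    O⁺   : S → Set
    O⁻   : S → Set
    u0   : List S

open OpenNet public

data Ev {Λ : Set} (Z : OpenNet Λ) : Set where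
  ev    : T Z → Ev Z
  plus  : (s : S Z) → .(O⁺ Z s) → Ev Z
  minus : (s : S Z) → .(O⁻ Z s) → Ev Z

module _ {Λ : Set} {Z : OpenNet Λ} where

  preEv : Ev Z → List (S Z)
  preEv (ev t)      = pre Z t
  preEv (plus s _)  = []
  preEv (minus s _) = [ s ]

  postEv : Ev Z → List (S Z)
  postEv (ev t)      = post Z t
  postEv (plus s _)  = [ s ]
  postEv (minus s _) = []

  pre* : List (Ev Z) → List (S Z)
  pre* = concatMap preEv

  post* : List (Ev Z) → List (S Z)
  post* = concatMap postEv

  minusPl : List (Ev Z) → List (S Z)
  minusPl = concatMap (λ { (minus s _) → [ s ] ; _ → [] })

  plusPl : List (Ev Z) → List (S Z)
  plusPl = concatMap (λ { (plus s _) → [ s ] ; _ → [] })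

  IsOpenEv : Ev Z → Set
  IsOpenEv (ev _) = ⊥
  IsOpenEv _      = ⊤

Step : {Λ : Set} (Z : OpenNet Λ) → List (S Z) → List (Ev Z) → List (S Z) → Set
Step Z m A m' = Σ (List (S Z)) λ u → (m ≋ (u ++ pre* A)) × (m' ≋ (u ++ post* A))

record NetMap {Λ : Set} (Z₁ Z₂ : OpenNet Λ) : Set where
  field
    fS : S Z₁ → S Z₂
    fT : T Z₁ → T Z₂

open NetMap public

module _ {Λ : Set} {Z₁ Z₂ : OpenNet Λ} (f : NetMap Z₁ Z₂) where

  -- s ∈ in(f)  iff  •f(s) ∖ f(•s) ≠ ∅
  In : S Z₁ → Set
  In s = Σ (T Z₂) λ t' → (fS f s ∈ post Z₂ t')
                        × ((t : T Z₁) → fT f t ≡ t' → ¬ (s ∈ post Z₁ t))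

  -- s ∈ out(f)  iff  f(s)• ∖ f(s•) ≠ ∅
  Out : S Z₁ → Set
  Out s = Σ (T Z₂) λ t' → (fS f s ∈ pre Z₂ t')
                         × ((t : T Z₁) → fT f t ≡ t' → ¬ (s ∈ pre Z₁ t))

  record IsNetMorphism : Set where
    field
      pre-pres  : (t : T Z₁) → pre Z₂ (fT f t) ≋ map (fS f) (pre Z₁ t)
      post-pres : (t : T Z₁) → post Z₂ (fT f t) ≋ map (fS f) (post Z₁ t)
      lab-pres  : (t : T Z₁) → lab Z₂ (fT f t) ≡ lab Z₁ t

  record IsOpenMorphism : Set where
    field
      isNetMorphism : IsNetMorphism
      O⁺-refl  : (s : S Z₁) → O⁺ Z₂ (fS f s) → O⁺ Z₁ s
      in⊆O⁺    : (s : S Z₁) → In s → O⁺ Z₁ s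
      O⁻-refl  : (s : S Z₁) → O⁻ Z₂ (fS f s) → O⁻ Z₁ s
      out⊆O⁻   : (s : S Z₁) → Out s → O⁻ Z₁ s
      init     : RestrEq (λ s → s) (u0 Z₁) (fS f) (u0 Z₂)

  record IsEmbedding : Set where
    field
      isOpenMorphism : IsOpenMorphism
      injS : Injective _≡_ _≡_ (fS f)
      injT : Injective _≡_ _≡_ (fT f)

  -- graph of the partial monoidal map f^⊕ on extended events
  MapsEv : Ev Z₁ → Ev Z₂ → Set
  MapsEv (ev t)      (ev t')      = fT f t ≡ t'
  MapsEv (plus s _)  (plus s' _)  = fS f s ≡ s'
  MapsEv (minus s _) (minus s' _) = fS f s ≡ s'
  MapsEv _           _            = ⊥

  -- ImgEq A B :  f^⊕(A) is defined and equals B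
  ImgEq : List (Ev Z₁) → List (Ev Z₂) → Set
  ImgEq A B = Σ (List (Ev Z₂)) λ B' → Pointwise MapsEv A B' × (B' ≋ B)

  -- OpenEvs B m p :  B = -_{m|_f} ⊕ +_{p|_f}   (m, p ∈ S_{Z₂}^⊕)
  OpenEvs : List (Ev Z₁) → List (S Z₂) → List (S Z₂) → Set
  OpenEvs B m p = All IsOpenEv B
                × ((s : S Z₁) → (s ∈ minusPl B) ↔ (fS f s ∈ m))
                × ((s : S Z₁) → (s ∈ plusPl B) ↔ (fS f s ∈ p))

  -- ProjEv e B :  e↓_f = B   (for a single extended event e of Z₂)
  ProjEv : Ev Z₂ → List (Ev Z₁) → Set
  ProjEv (ev t')      B = (Σ (T Z₁) λ t → (fT f t ≡ t') × (B ≡ [ ev t ]))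
                        ⊎ (((t : T Z₁) → fT f t ≢ t') × OpenEvs B (pre Z₂ t') (post Z₂ t'))
  ProjEv (plus s' _)  B = OpenEvs B [] [ s' ]
  ProjEv (minus s' _) B = OpenEvs B [ s' ] []

  -- ProjEq A' A :  A'↓_f = A
  ProjEq : List (Ev Z₂) → List (Ev Z₁) → Set
  ProjEq A' A = Σ (List (List (Ev Z₁))) λ Bs → Pointwise ProjEv A' Bs × (concat Bs ≋ A)

module _ {Λ : Set} {Z₀ Z₁ Z₂ : OpenNet Λ} where

  record Composable (f₁ : NetMap Z₀ Z₁) (f₂ : NetMap Z₀ Z₂) : Set where
    field
      in₁  : (s : S Z₀) → In f₁ s  → O⁺ Z₂ (fS f₂ s)
      out₁ : (s : S Z₀) → Out f₁ s → O⁻ Z₂ (fS f₂ s)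
      in₂  : (s : S Z₀) → In f₂ s  → O⁺ Z₁ (fS f₁ s)
      out₂ : (s : S Z₀) → Out f₂ s → O⁻ Z₁ (fS f₁ s)

-- C with a₁ : B₁ → C, a₂ : B₂ → C is the pushout in sets of the
-- injections g₁ : A → B₁, g₂ : A → B₂ (explicit description of the
-- pushout of sets along injections).
record IsSetPushout {A B₁ B₂ C : Set} (g₁ : A → B₁) (g₂ : A → B₂)
                    (a₁ : B₁ → C) (a₂ : B₂ → C) : Set where
  field
    commute : (x : A) → a₁ (g₁ x) ≡ a₂ (g₂ x)
    inj₁    : Injective _≡_ _≡_ a₁
    inj₂    : Injective _≡_ _≡_ a₂
    jsurj   : (c : C) → (∃ λ b → a₁ b ≡ c) ⊎ (∃ λ b → a₂ b ≡ c)
    glue    : (b₁ : B₁) (b₂ : B₂) → a₁ b₁ ≡ a₂ b₂ → ∃ λ x → (g₁ x ≡ b₁) × (g₂ x ≡ b₂)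

module _ {Λ : Set} {Z₀ Z₁ Z₂ Z₃ : OpenNet Λ} where

  record IsComposition (f₁ : NetMap Z₀ Z₁) (f₂ : NetMap Z₀ Z₂)
                       (α₁ : NetMap Z₁ Z₃) (α₂ : NetMap Z₂ Z₃) : Set where
    field
      pushoutS : IsSetPushout (fS f₁) (fS f₂) (fS α₁) (fS α₂)
      pushoutT : IsSetPushout (fT f₁) (fT f₂) (fT α₁) (fT α₂)
      net₁     : IsNetMorphism α₁
      net₂     : IsNetMorphism α₂
      O⁺-def   : (s : S Z₃) → (O⁺ Z₃ s → ((s₁ : S Z₁) → fS α₁ s₁ ≡ s → O⁺ Z₁ s₁)
                                        × ((s₂ : S Z₂) → fS α₂ s₂ ≡ s → O⁺ Z₂ s₂))
                             × (((s₁ : S Z₁) → fS α₁ s₁ ≡ s → O⁺ Z₁ s₁)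
                                 → ((s₂ : S Z₂) → fS α₂ s₂ ≡ s → O⁺ Z₂ s₂) → O⁺ Z₃ s)
      O⁻-def   : (s : S Z₃) → (O⁻ Z₃ s → ((s₁ : S Z₁) → fS α₁ s₁ ≡ s → O⁻ Z₁ s₁)
                                        × ((s₂ : S Z₂) → fS α₂ s₂ ≡ s → O⁻ Z₂ s₂))
                             × (((s₁ : S Z₁) → fS α₁ s₁ ≡ s → O⁻ Z₁ s₁)
                                 → ((s₂ : S Z₂) → fS α₂ s₂ ≡ s → O⁻ Z₂ s₂) → O⁻ Z₃ s)
      init₁    : RestrEq (fS α₁) (u0 Z₃) (λ s → s) (u0 Z₁)
      init₂    : RestrEq (fS α₂) (u0 Z₃) (λ s → s) (u0 Z₂)

-- u₁ ⊎ u₂ is the unique u₃ with u₃|_{α₁} = u₁ and u₃|_{α₂} = u₂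
module _ {Λ : Set} {Z₁ Z₂ Z₃ : OpenNet Λ} where

  IsUnion : NetMap Z₁ Z₃ → NetMap Z₂ Z₃ → List (S Z₁) → List (S Z₂) → List (S Z₃) → Set
  IsUnion α₁ α₂ u₁ u₂ u₃ = RestrEq (fS α₁) u₃ (λ s → s) u₁ × RestrEq (fS α₂) u₃ (λ s → s) u₂

module Submission where

-- Markings are lists up to bag equality, so every statement is a family
-- of bijections between position types (x ∈ u).
-- The theorem follows: the places of A₁ and A₂ are the two restrictions
-- of those of A₃, so (2) gives both the agreement of the targets on Z₀
-- and the glued step.

open import Defs
open import Axiom.UniquenessOfIdentityProofs.WithK using (uip)
open import Data.Bool using (Bool; true; false; if_then_else_) renaming (T to True)
open import Data.Irrelevant using (Irrelevant) renaming ([_] to hide)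
open import Data.List using (List; []; _∷_; _++_; map; concat; concatMap; [_])
open import Data.List.Membership.Propositional using (_∈_)
open import Data.List.Membership.Propositional.Properties
  using (map-∈↔; ∈-++⁺ˡ; ∈-++⁺ʳ)
open import Data.List.Properties using (map-++; concatMap-++; ++-identityʳ)
open import Data.List.Relation.Binary.BagAndSetEquality
  using (map-cong; ++-cong; concat-cong)
open import Data.List.Relation.Binary.Pointwise using (Pointwise; []; _∷_)
open import Data.List.Relation.Binary.Subset.Propositional using (_⊆_)
open import Data.List.Relation.Binary.Subset.Propositional.Properties using (concatMap⁺)
open import Data.List.Relation.Unary.All using (All; _∷_)
open import Data.List.Relation.Unary.Any using (here; there)
open import Data.List.Relation.Unary.Any.Properties using (++↔; ∷↔; map↔; Any-cong)
open import Data.Product using (Σ; ∃; _×_; _,_; proj₁; proj₂)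
import Data.Product.Function.Dependent.Propositional as Σ
open import Data.Product.Function.NonDependent.Propositional using (_×-↔_)
open import Data.Sum using (_⊎_; inj₁; inj₂)
open import Data.Sum.Function.Propositional using (_⊎-↔_)
open import Data.Sum.Properties using (inj₁-injective; inj₂-injective)
open import Data.Unit using (tt)
open import Function using (id)
open import Function.Bundles using (_↔_; Inverse; mk↔ₛ′)
open import Function.Definitions using (Injective)
open import Function.Properties.Inverse using (↔-refl; ↔-sym; ↔-trans; to-from)
open import Function.Related.TypeIsomorphisms using (⊎-assoc; ⊎-comm)
open import Relation.Binary.PropositionalEquality
  using (_≡_; refl; sym; trans; cong; subst)
open import Relation.Nullary using (contradiction)

open Inverse using (to; from)

infixr 5 _⟫_
_⟫_ : {A B C : Set} → A ↔ B → B ↔ C → A ↔ C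
_⟫_ = ↔-trans

-- 1. Membership bijections

module _ {X : Set} where

  ∈-++ : {xs ys : List X} {x : X} → (x ∈ xs ++ ys) ↔ (x ∈ xs ⊎ x ∈ ys)
  ∈-++ = ↔-sym ++↔

  ≡⇒≋ : {xs ys : List X} → xs ≡ ys → xs ≋ ys
  ≡⇒≋ refl = ↔-refl

  ∈-map-injective : {Y : Set} {f : X → Y} → Injective _≡_ _≡_ f →
                    (xs : List X) {x : X} → (x ∈ xs) ↔ (f x ∈ map f xs)
  ∈-map-injective {f = f} f-inj xs =
    Any-cong (λ _ → cong-eq) ↔-refl ⟫ map↔
    where
    cong-eq : {x y : X} → (x ≡ y) ↔ (f x ≡ f y)
    cong-eq = mk↔ₛ′ (cong f) f-inj (λ _ → uip _ _) (λ _ → uip _ _)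

-- Cancellation of a propositional summand: an element of A sent into P
-- by φ is sent by φ once more into B ("detour"); the detour relation is
-- total, functional, and reversed by φ⁻¹, so it is a bijection A ↔ B.
module Cancellation {P : Set} (P-prop : (p q : P) → p ≡ q) where

  Detour : {A B : Set} → (P ⊎ A) ↔ (P ⊎ B) → A → B → Set
  Detour φ a b = (to φ (inj₂ a) ≡ inj₂ b)
               ⊎ (∃ λ p → (to φ (inj₂ a) ≡ inj₁ p) × (to φ (inj₁ p) ≡ inj₂ b))

  -- Every a has a detour target (the second step cannot land in P again).
  detour-total : {A B : Set} (φ : (P ⊎ A) ↔ (P ⊎ B)) (a : A) → ∃ (Detour φ a)
  detour-total φ a with to φ (inj₂ a) in e₁
  ... | inj₂ b = b , inj₁ refl
  ... | inj₁ p with to φ (inj₁ p) in e₂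
  ...   | inj₂ b  = b , inj₂ (p , refl , e₂)
  ...   | inj₁ p′ = contradiction
          (trans (sym (to-from φ e₁)) (to-from φ (trans e₂ (cong inj₁ (P-prop p′ p)))))
          λ ()

  detour-functional : {A B : Set} (φ : (P ⊎ A) ↔ (P ⊎ B)) {a : A} {b b′ : B} →
                      Detour φ a b → Detour φ a b′ → b ≡ b′
  detour-functional φ (inj₁ e) (inj₁ e′) = inj₂-injective (trans (sym e) e′)
  detour-functional φ (inj₁ e) (inj₂ (_ , e₁ , _)) = contradiction (trans (sym e) e₁) λ ()
  detour-functional φ (inj₂ (_ , e₁ , _)) (inj₁ e) = contradiction (trans (sym e₁) e) λ ()
  detour-functional φ (inj₂ (p , e₁ , e₂)) (inj₂ (p′ , e₁′ , e₂′))
    with inj₁-injective (trans (sym e₁) e₁′)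
  ... | refl = inj₂-injective (trans (sym e₂) e₂′)

  detour-converse : {A B : Set} (φ : (P ⊎ A) ↔ (P ⊎ B)) {a : A} {b : B} →
                    Detour φ a b → Detour (↔-sym φ) b a
  detour-converse φ (inj₁ e)             = inj₁ (to-from φ e)
  detour-converse φ (inj₂ (p , e₁ , e₂)) = inj₂ (p , to-from φ e₂ , to-from φ e₁)

  ⊎-cancelˡ : {A B : Set} → (P ⊎ A) ↔ (P ⊎ B) → A ↔ B
  ⊎-cancelˡ φ = mk↔ₛ′ (forth φ) (forth (↔-sym φ)) (back-forth (↔-sym φ)) (back-forth φ)
    where
    forth : {A B : Set} → (P ⊎ A) ↔ (P ⊎ B) → A → B
    forth ψ a = proj₁ (detour-total ψ a)

    back-forth : {A B : Set} (ψ : (P ⊎ A) ↔ (P ⊎ B)) (a : A) → forth (↔-sym ψ) (forth ψ a) ≡ a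
    back-forth ψ a = detour-functional (↔-sym ψ)
      (proj₂ (detour-total (↔-sym ψ) (forth ψ a)))
      (detour-converse ψ (proj₂ (detour-total ψ a)))

∈-cancel : {X A B : Set} (L : List X) {x : X} → (A ⊎ x ∈ L) ↔ (B ⊎ x ∈ L) → A ↔ B
∈-cancel []      φ = ↔-sym drop-[] ⟫ φ ⟫ drop-[]
  where
  drop-[] : {A : Set} {x : _} → (A ⊎ x ∈ []) ↔ A
  drop-[] = mk↔ₛ′ (λ { (inj₁ a) → a ; (inj₂ ()) }) inj₁
                  (λ _ → refl) (λ { (inj₁ _) → refl ; (inj₂ ()) })
∈-cancel (y ∷ L) φ = ∈-cancel L (Cancellation.⊎-cancelˡ uip (↔-sym head-first ⟫ φ ⟫ head-first))
  where
  head-first : {A : Set} {x : _} → (A ⊎ x ∈ y ∷ L) ↔ (x ≡ y ⊎ (A ⊎ x ∈ L))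
  head-first {A} {x} = (↔-refl ⊎-↔ ↔-sym (∷↔ _))
                     ⟫ ↔-sym (⊎-assoc _ A (x ≡ y) (x ∈ L))
                     ⟫ (⊎-comm A (x ≡ y) ⊎-↔ ↔-refl)
                     ⟫ ⊎-assoc _ (x ≡ y) A (x ∈ L)

select : {X : Set} (m : List X) → ({z : X} → z ∈ m → Bool) → List X
select []      keep = []
select (y ∷ m) keep = (if keep (here refl) then [ y ] else []) ++ select m (λ i → keep (there i))

select-∈ : {X : Set} (m : List X) (keep : {z : X} → z ∈ m → Bool) {z : X} →
           (z ∈ select m keep) ↔ Σ (z ∈ m) (λ i → True (keep i))
select-∈ []      keep = mk↔ₛ′ (λ ()) (λ { (() , _) }) (λ { (() , _) }) (λ ())
select-∈ (y ∷ m) keep =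
  ∈-++ ⟫ ((∈-if (keep (here refl)) ⟫ flag-at-here) ⊎-↔ select-∈ m (λ i → keep (there i)))
       ⟫ ↔-sym positions-∷
  where
  ∈-if : {z : _} (b : Bool) → (z ∈ (if b then [ y ] else [])) ↔ ((z ≡ y) × True b)
  ∈-if true  = mk↔ₛ′ (λ { (here p) → p , tt }) (λ (p , _) → here p)
                     (λ _ → refl) (λ { (here _) → refl })
  ∈-if false = mk↔ₛ′ (λ ()) (λ { (_ , ()) }) (λ { (_ , ()) }) (λ ())

  flag-at-here : {z : _} → ((z ≡ y) × True (keep (here refl))) ↔ Σ (z ≡ y) (λ p → True (keep (here p)))
  flag-at-here = mk↔ₛ′ (λ { (refl , t) → refl , t }) (λ { (refl , t) → refl , t })
                       (λ { (refl , _) → refl }) (λ { (refl , _) → refl })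

  positions-∷ : {z : _} {F : z ∈ y ∷ m → Set} →
                Σ (z ∈ y ∷ m) F ↔ (Σ (z ≡ y) (λ p → F (here p)) ⊎ Σ (z ∈ m) (λ i → F (there i)))
  positions-∷ = mk↔ₛ′ (λ { (here p , t) → inj₁ (p , t) ; (there i , t) → inj₂ (i , t) })
                      (λ { (inj₁ (p , t)) → here p , t ; (inj₂ (i , t)) → there i , t })
                      (λ { (inj₁ _) → refl ; (inj₂ _) → refl })
                      (λ { (here _ , _) → refl ; (there _ , _) → refl })

remainder : {X : Set} (m : List X) {W Q : X → Set} →
            ((z : X) → (z ∈ m) ↔ (W z ⊎ Q z)) →
            Σ (List X) λ w → (z : X) → (z ∈ w) ↔ W z
remainder m {W} {Q} φ = select m (λ {z} i → is-left (to (φ z) i)) ,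
  λ z → select-∈ m _ ⟫ Σ.cong (φ z) ↔-refl ⟫ left-part
  where
  is-left : {A B : Set} → A ⊎ B → Bool
  is-left (inj₁ _) = true
  is-left (inj₂ _) = false

  left-part : {z : _} → Σ (W z ⊎ Q z) (λ c → True (is-left c)) ↔ W z
  left-part = mk↔ₛ′ (λ { (inj₁ w , _) → w ; (inj₂ _ , ()) }) (λ w → inj₁ w , tt)
                    (λ _ → refl) (λ { (inj₁ _ , _) → refl ; (inj₂ _ , ()) })

-- 2. Restrictions, unions, and steps

Union : {X₁ X₂ X₃ : Set} → (X₁ → X₃) → (X₂ → X₃) → List X₁ → List X₂ → List X₃ → Set
Union a₁ a₂ m₁ m₂ m₃ = RestrEq a₁ m₃ id m₁ × RestrEq a₂ m₃ id m₂

union-restrict : {X₀ X₁ X₂ X₃ : Set} {g₁ : X₀ → X₁} {g₂ : X₀ → X₂}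
                 {a₁ : X₁ → X₃} {a₂ : X₂ → X₃} {m₁ : List X₁} {m₂ : List X₂} {m₃ : List X₃} →
                 ((x : X₀) → a₁ (g₁ x) ≡ a₂ (g₂ x)) →
                 Union a₁ a₂ m₁ m₂ m₃ → RestrEq g₁ m₁ g₂ m₂
union-restrict {g₁ = g₁} {g₂} {m₁ = m₁} {m₃ = m₃} commute (m₁-part , m₂-part) x =
  ↔-sym (subst (λ z → (z ∈ m₃) ↔ (g₁ x ∈ m₁)) (commute x) (m₁-part (g₁ x)))
  ⟫ m₂-part (g₂ x)

step-restrict : {Λ : Set} {Z₁ Z₂ : OpenNet Λ} {X : Set} {g₁ : X → S Z₁} {g₂ : X → S Z₂}
                {u₁ v₁ : List (S Z₁)} {A₁ : List (Ev Z₁)} {u₂ v₂ : List (S Z₂)} {A₂ : List (Ev Z₂)} →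
                Step Z₁ u₁ A₁ v₁ → Step Z₂ u₂ A₂ v₂ →
                RestrEq g₁ u₁ g₂ u₂ →
                RestrEq g₁ (pre* A₁) g₂ (pre* A₂) → RestrEq g₁ (post* A₁) g₂ (post* A₂) →
                RestrEq g₁ v₁ g₂ v₂
step-restrict {A₁ = A₁} (w₁ , U₁ , V₁) (w₂ , U₂ , V₂) u-agree pre-agree post-agree x =
  V₁ ⟫ ∈-++ ⟫ (w-agree ⊎-↔ post-agree x) ⟫ ↔-sym ∈-++ ⟫ ↔-sym V₂
  where
  w-agree = ∈-cancel (pre* A₁)
    (↔-sym ∈-++ ⟫ ↔-sym U₁ ⟫ u-agree x ⟫ U₂ ⟫ ∈-++ ⟫ (↔-refl ⊎-↔ ↔-sym (pre-agree x)))

step-from-remainder : {Λ : Set} {Z : OpenNet Λ} {m m′ : List (S Z)} {A : List (Ev Z)}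
                      (W : S Z → Set) →
                      ((z : S Z) → (z ∈ m) ↔ (W z ⊎ z ∈ pre* A)) →
                      ((z : S Z) → (z ∈ m′) ↔ (W z ⊎ z ∈ post* A)) →
                      Step Z m A m′
step-from-remainder {m = m} W source target with remainder m source
... | w , w-is-W = w , (λ {z} → source z ⟫ (↔-sym (w-is-W z) ⊎-↔ ↔-refl) ⟫ ↔-sym ∈-++)
                     , (λ {z} → target z ⟫ (↔-sym (w-is-W z) ⊎-↔ ↔-refl) ⟫ ↔-sym ∈-++)

Preimage : {X₁ X₂ X₃ : Set} → (X₁ → X₃) → (X₂ → X₃) → X₃ → Set
Preimage a₁ a₂ z = (∃ λ b → a₁ b ≡ z) ⊎ (∃ λ b → a₂ b ≡ z)

-- Gluing along a jointly surjective pair a₁, a₂: every point z of X₃ is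
-- chosen to come from X₁ or from X₂, and its remainder is read there.
module Glue {X₁ X₂ X₃ : Set} {a₁ : X₁ → X₃} {a₂ : X₂ → X₃}
            (cover : (z : X₃) → Preimage a₁ a₂ z) where

  remainder-at : {z : X₃} → List X₁ → List X₂ → Preimage a₁ a₂ z → Set
  remainder-at w₁ w₂ (inj₁ (b , _)) = b ∈ w₁
  remainder-at w₁ w₂ (inj₂ (b , _)) = b ∈ w₂

  union-split : {m₁ w₁ p₁ : List X₁} {m₂ w₂ p₂ : List X₂} {m₃ p₃ : List X₃} →
                Union a₁ a₂ m₁ m₂ m₃ → Union a₁ a₂ p₁ p₂ p₃ →
                m₁ ≋ (w₁ ++ p₁) → m₂ ≋ (w₂ ++ p₂) →
                (z : X₃) → (z ∈ m₃) ↔ (remainder-at w₁ w₂ (cover z) ⊎ z ∈ p₃)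
  union-split {w₁ = w₁} {w₂ = w₂} {m₃ = m₃} {p₃ = p₃}
              (m₁-part , m₂-part) (p₁-part , p₂-part) M₁ M₂ z =
    split-at z (cover z)
    where
    split-at : (z : X₃) (o : Preimage a₁ a₂ z) → (z ∈ m₃) ↔ (remainder-at w₁ w₂ o ⊎ z ∈ p₃)
    split-at _ (inj₁ (b , refl)) = m₁-part b ⟫ M₁ ⟫ ∈-++ ⟫ (↔-refl ⊎-↔ ↔-sym (p₁-part b))
    split-at _ (inj₂ (b , refl)) = m₂-part b ⟫ M₂ ⟫ ∈-++ ⟫ (↔-refl ⊎-↔ ↔-sym (p₂-part b))

step-union : {Λ : Set} {Z₁ Z₂ Z₃ : OpenNet Λ} {a₁ : S Z₁ → S Z₃} {a₂ : S Z₂ → S Z₃}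
             {u₁ v₁ : List (S Z₁)} {A₁ : List (Ev Z₁)} {u₂ v₂ : List (S Z₂)} {A₂ : List (Ev Z₂)}
             {u₃ v₃ : List (S Z₃)} {A₃ : List (Ev Z₃)} →
             ((z : S Z₃) → Preimage a₁ a₂ z) →
             Step Z₁ u₁ A₁ v₁ → Step Z₂ u₂ A₂ v₂ →
             Union a₁ a₂ u₁ u₂ u₃ → Union a₁ a₂ v₁ v₂ v₃ →
             Union a₁ a₂ (pre* A₁) (pre* A₂) (pre* A₃) →
             Union a₁ a₂ (post* A₁) (post* A₂) (post* A₃) →
             Step Z₃ u₃ A₃ v₃
step-union {A₃ = A₃} cover (w₁ , U₁ , V₁) (w₂ , U₂ , V₂) u-union v-union pre-union post-union =
  step-from-remainder {A = A₃} (λ z → remainder-at {z} w₁ w₂ (cover z))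
    (union-split u-union pre-union U₁ U₂) (union-split v-union post-union V₁ V₂)
  where open Glue cover

-- 3. Pushouts of sets along injections

module Pushout {A B₁ B₂ C : Set} {g₁ : A → B₁} {g₂ : A → B₂} {a₁ : B₁ → C} {a₂ : B₂ → C}
               (pushout : IsSetPushout g₁ g₂ a₁ a₂) (g₁-inj : Injective _≡_ _≡_ g₁) where

  open IsSetPushout pushout

  Glued Shared : (B₁ → Set) → B₂ → Set
  Glued  P b = Σ B₁ (λ y → P y × a₂ b ≡ a₁ y)
  Shared P b = Σ A (λ x → P (g₁ x) × b ≡ g₂ x)

  private
    to-A : {P : B₁ → Set} {b : B₂} → Glued P b → Shared P b
    to-A {b = b} (y , p , e) with glue y b (sym e)
    ... | x , refl , e₂ = x , p , sym e₂

    to-B₁ : {P : B₁ → Set} {b : B₂} → Shared P b → Glued P b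
    to-B₁ (x , p , refl) = g₁ x , p , sym (commute x)

    to-B₁-to-A : {P : B₁ → Set} {b : B₂} (w : Glued P b) → to-B₁ (to-A w) ≡ w
    to-B₁-to-A {b = b} (y , p , e) with glue y b (sym e)
    ... | x , refl , refl = cong (λ e′ → g₁ x , p , e′) (uip _ _)

    to-A-to-B₁ : {P : B₁ → Set} {b : B₂} (w : Shared P b) → to-A {P} (to-B₁ w) ≡ w
    to-A-to-B₁ (x , p , refl) with glue (g₁ x) (g₂ x) (sym (sym (commute x)))
    ... | x′ , e₁ , e₂ with g₁-inj e₁
    ...   | refl rewrite uip e₁ refl | uip e₂ refl = refl

  -- The square is a pullback: the elements of B₁ identified with a₂ b are
  -- exactly the g₁-images of the elements of A sent to b (fibred over P).
  pullback-fibre : {P : B₁ → Set} {b : B₂} → Glued P b ↔ Shared P b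
  pullback-fibre = mk↔ₛ′ to-A to-B₁ to-A-to-B₁ to-B₁-to-A

  pushout-restrict : {L₀ : List A} {L₁ : List B₁} → RestrEq id L₀ g₁ L₁ →
                     RestrEq a₂ (map a₁ L₁) id (map g₂ L₀)
  pushout-restrict L₀-restricts b =
    ↔-sym (map-∈↔ a₁) ⟫ pullback-fibre
    ⟫ Σ.congˡ (↔-sym (L₀-restricts _) ×-↔ ↔-refl) ⟫ map-∈↔ g₂

-- 4. Places of extended events

data Side : Set where
  consumed produced : Side

module _ {Λ : Set} {Z : OpenNet Λ} where

  placesEv : Side → Ev Z → List (S Z)
  placesEv consumed = preEv
  placesEv produced = postEv

  places : Side → List (Ev Z) → List (S Z)
  places σ = concatMap (placesEv σ)

  boundaryPl : Side → List (Ev Z) → List (S Z)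
  boundaryPl consumed = minusPl
  boundaryPl produced = plusPl

  places-cong : (σ : Side) {A A′ : List (Ev Z)} → A ≋ A′ → places σ A ≋ places σ A′
  places-cong σ A≋A′ = concat-cong (map-cong (λ _ → refl) A≋A′)

  places-boundary : (σ : Side) {B : List (Ev Z)} → All IsOpenEv B → places σ B ≡ boundaryPl σ B
  places-boundary consumed {[]}            _            = refl
  places-boundary produced {[]}            _            = refl
  places-boundary σ        {ev _ ∷ _}      (() ∷ _)
  places-boundary consumed {plus _ _ ∷ _}  (_ ∷ open-B) = places-boundary consumed open-B
  places-boundary consumed {minus s _ ∷ _} (_ ∷ open-B) = cong (s ∷_) (places-boundary consumed open-B)
  places-boundary produced {plus s _ ∷ _}  (_ ∷ open-B) = cong (s ∷_) (places-boundary produced open-B)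
  places-boundary produced {minus _ _ ∷ _} (_ ∷ open-B) = places-boundary produced open-B

  boundaryPl-mono : (σ : Side) {B X : List (Ev Z)} → B ⊆ X → boundaryPl σ B ⊆ boundaryPl σ X
  boundaryPl-mono consumed B⊆X = concatMap⁺ _ B⊆X
  boundaryPl-mono produced B⊆X = concatMap⁺ _ B⊆X

Open : {Λ : Set} (Z : OpenNet Λ) → Side → S Z → Set
Open Z consumed = O⁻ Z
Open Z produced = O⁺ Z

boundary : {Λ : Set} {Z : OpenNet Λ} (σ : Side) (s : S Z) → .(Open Z σ s) → Ev Z
boundary consumed = minus
boundary produced = plus

module _ {Λ : Set} {Z Z′ : OpenNet Λ} (f : NetMap Z Z′) where

  placesEv-image : IsNetMorphism f → (σ : Side) {e : Ev Z} {e′ : Ev Z′} →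
                   MapsEv f e e′ → placesEv σ e′ ≋ map (fS f) (placesEv σ e)
  placesEv-image net consumed {ev t}      {ev _}      refl = IsNetMorphism.pre-pres net t
  placesEv-image net produced {ev t}      {ev _}      refl = IsNetMorphism.post-pres net t
  placesEv-image net consumed {plus _ _}  {plus _ _}  refl = ↔-refl
  placesEv-image net produced {plus _ _}  {plus _ _}  refl = ↔-refl
  placesEv-image net consumed {minus _ _} {minus _ _} refl = ↔-refl
  placesEv-image net produced {minus _ _} {minus _ _} refl = ↔-refl

  image-places : IsNetMorphism f → {A : List (Ev Z)} {A′ : List (Ev Z′)} →
                 ImgEq f A A′ → (σ : Side) → places σ A′ ≋ map (fS f) (places σ A)
  image-places net (B , A↦B , B≋A′) σ = places-cong σ (↔-sym B≋A′) ⟫ pointwise A↦B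
    where
    pointwise : {A : List (Ev Z)} {B : List (Ev Z′)} →
                Pointwise (MapsEv f) A B → places σ B ≋ map (fS f) (places σ A)
    pointwise []                   = ↔-refl
    pointwise {e ∷ A} (e↦ ∷ A↦B) =
      ++-cong (placesEv-image net σ e↦) (pointwise A↦B)
      ⟫ ≡⇒≋ (sym (map-++ (fS f) (placesEv σ e) (places σ A)))

  boundary-image-open : {X : List (Ev Z)} {Y : List (Ev Z′)} → Pointwise (MapsEv f) X Y →
                        (σ : Side) {x : S Z} → x ∈ boundaryPl σ X → Irrelevant (Open Z′ σ (fS f x))
  boundary-image-open (_∷_ {x = ev _}      _ X↦Y) consumed x∈ = boundary-image-open X↦Y consumed x∈
  boundary-image-open (_∷_ {x = ev _}      _ X↦Y) produced x∈ = boundary-image-open X↦Y produced x∈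
  boundary-image-open (_∷_ {x = plus _ _}  _ X↦Y) consumed x∈ = boundary-image-open X↦Y consumed x∈
  boundary-image-open (_∷_ {x = minus _ _} _ X↦Y) produced x∈ = boundary-image-open X↦Y produced x∈
  boundary-image-open (_∷_ {x = minus _ _} {y = minus _ q} refl _) consumed (here refl) = hide q
  boundary-image-open (_∷_ {x = plus _ _}  {y = plus _ q}  refl _) produced (here refl) = hide q
  boundary-image-open (_∷_ {x = minus _ _} _ X↦Y) consumed (there x∈) = boundary-image-open X↦Y consumed x∈
  boundary-image-open (_∷_ {x = plus _ _}  _ X↦Y) produced (there x∈) = boundary-image-open X↦Y produced x∈

  module _ (emb : IsEmbedding f) where
    open IsEmbedding emb using (injS; isOpenMorphism)
    open IsOpenMorphism isOpenMorphism using (isNetMorphism)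

    open-places : (σ : Side) {e : Ev Z′} {B : List (Ev Z)} →
                  OpenEvs f B (preEv e) (postEv e) → RestrEq id (places σ B) (fS f) (placesEv σ e)
    open-places consumed (open-B , minus-part , _) x = ≡⇒≋ (places-boundary consumed open-B) ⟫ minus-part x
    open-places produced (open-B , _ , plus-part)  x = ≡⇒≋ (places-boundary produced open-B) ⟫ plus-part x

    projEv-places : (σ : Side) {e : Ev Z′} {B : List (Ev Z)} →
                    ProjEv f e B → RestrEq id (places σ B) (fS f) (placesEv σ e)
    projEv-places σ {ev _} (inj₁ (t , refl , refl)) x =
      ≡⇒≋ (++-identityʳ (placesEv σ (ev t)))
      ⟫ ∈-map-injective injS (placesEv σ (ev t))
      ⟫ ↔-sym (placesEv-image isNetMorphism σ {ev t} refl)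
    projEv-places σ {ev t′}      (inj₂ (_ , open-B)) = open-places σ {ev t′} open-B
    projEv-places σ {plus s′ _}  open-B              = open-places σ {plus s′ _} open-B
    projEv-places σ {minus s′ _} open-B              = open-places σ {minus s′ _} open-B

    projection-places : {A : List (Ev Z′)} {X : List (Ev Z)} → ProjEq f A X →
                        (σ : Side) → RestrEq id (places σ X) (fS f) (places σ A)
    projection-places (Bs , A↓Bs , concat≋X) σ x = places-cong σ (↔-sym concat≋X) ⟫ pointwise A↓Bs
      where
      pointwise : {A : List (Ev Z′)} {Bs : List (List (Ev Z))} →
                  Pointwise (ProjEv f) A Bs → (x ∈ places σ (concat Bs)) ↔ (fS f x ∈ places σ A)
      pointwise []                  = mk↔ₛ′ (λ ()) (λ ()) (λ ()) (λ ())
      pointwise {Bs = B ∷ Bs} (e↓B ∷ A↓Bs) =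
        ≡⇒≋ (concatMap-++ (placesEv σ) B (concat Bs))
        ⟫ ∈-++ ⟫ (projEv-places σ e↓B x ⊎-↔ pointwise A↓Bs) ⟫ ↔-sym ∈-++

-- 5. The composed event A₃ = α₁^⊕(A₁)

module Composite {Λ : Set} {Z₀ Z₁ Z₂ Z₃ : OpenNet Λ}
                 {f₁ : NetMap Z₀ Z₁} {f₂ : NetMap Z₀ Z₂} {α₁ : NetMap Z₁ Z₃} {α₂ : NetMap Z₂ Z₃}
                 (emb₁ : IsEmbedding f₁) (emb₂ : IsEmbedding f₂)
                 (composition : IsComposition f₁ f₂ α₁ α₂)
                 {A₁ : List (Ev Z₁)} {X : List (Ev Z₀)} {A₂ : List (Ev Z₂)}
                 (A₁↓X : ProjEq f₁ A₁ X) (X↦A₂ : ImgEq f₂ X A₂) where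

  open IsComposition composition
  open IsSetPushout pushoutS using (glue) renaming (inj₁ to α₁-injective)

  X-maps : Pointwise (MapsEv f₂) X (proj₁ X↦A₂)
  X-maps = proj₁ (proj₂ X↦A₂)

  open-glued : (σ : Side) (s : S Z₃) →
               ((s₁ : S Z₁) → fS α₁ s₁ ≡ s → Open Z₁ σ s₁) →
               ((s₂ : S Z₂) → fS α₂ s₂ ≡ s → Open Z₂ σ s₂) → Open Z₃ σ s
  open-glued consumed s = proj₂ (O⁻-def s)
  open-glued produced s = proj₂ (O⁺-def s)

  boundary-maps : (σ : Side) {s : S Z₁} .{p : Open Z₁ σ s} .{q : Open Z₃ σ (fS α₁ s)} →
                  MapsEv α₁ (boundary σ s p) (boundary σ (fS α₁ s) q)
  boundary-maps consumed = refl
  boundary-maps produced = refl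

  -- Every place s₂ of Z₂ glued to a place s of Z₁ is open when the
  -- boundary places L of the projection of σ_s (the x with f₁ x = s)
  -- occur in X: then s₂ = f₂ x and the f₂-image of σ_x is defined.
  glued-open : (σ : Side) (s : S Z₁) (L : List (S Z₀)) →
               ((x : S Z₀) → (x ∈ L) ↔ (fS f₁ x ∈ [ s ])) → L ⊆ boundaryPl σ X →
               Irrelevant ((s₂ : S Z₂) → fS α₂ s₂ ≡ fS α₁ s → Open Z₂ σ s₂)
  glued-open σ s [] L-is-s _ = hide λ s₂ e → no-preimage (glue s s₂ (sym e))
    where
    no-preimage : {s₂ : S Z₂} → ∃ (λ x → (fS f₁ x ≡ s) × (fS f₂ x ≡ s₂)) → Open Z₂ σ s₂
    no-preimage (x , f₁x≡s , _) = contradiction (from (L-is-s x) (here f₁x≡s)) λ ()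
  glued-open σ s (y ∷ _) L-is-s L⊆X
    with boundary-image-open f₂ X-maps σ (L⊆X (here refl))
  ... | hide f₂y-open = hide λ s₂ e → subst (Open Z₂ σ) (f₂y≡s₂ s₂ e) f₂y-open
    where
    f₁y≡s : fS f₁ y ≡ s
    f₁y≡s with to (L-is-s y) (here refl)
    ... | here eq = eq

    f₂y≡s₂ : (s₂ : S Z₂) → fS α₂ s₂ ≡ fS α₁ s → fS f₂ y ≡ s₂
    f₂y≡s₂ s₂ e with glue s s₂ (sym e)
    ... | x , f₁x≡s , f₂x≡s₂ =
      trans (cong (fS f₂) (IsEmbedding.injS emb₁ (trans f₁y≡s (sym f₁x≡s)))) f₂x≡s₂

  -- A boundary event σ_s of A₁ has an α₁-image: s is open in Z₁ and every
  -- place of Z₂ glued to s is open.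
  lift-boundary : (σ : Side) (s : S Z₁) .(p : Open Z₁ σ s) {B : List (Ev Z₀)} →
                  ((x : S Z₀) → (x ∈ boundaryPl σ B) ↔ (fS f₁ x ∈ [ s ])) → B ⊆ X →
                  Σ (Ev Z₃) (MapsEv α₁ (boundary σ s p))
  lift-boundary σ s p {B} B-boundary B⊆X
    with glued-open σ s (boundaryPl σ B) B-boundary (boundaryPl-mono σ B⊆X)
  ... | hide Z₂-open =
    boundary σ (fS α₁ s)
      (open-glued σ (fS α₁ s) (λ s₁ e → subst (Open Z₁ σ) (sym (α₁-injective e)) p) Z₂-open)
    , boundary-maps σ

  lift-event : (e : Ev Z₁) {B : List (Ev Z₀)} → ProjEv f₁ e B → B ⊆ X → Σ (Ev Z₃) (MapsEv α₁ e)
  lift-event (ev t)      _                        _   = ev (fT α₁ t) , refl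
  lift-event (plus s p)  (_ , _ , plus-part)      B⊆X = lift-boundary produced s p plus-part B⊆X
  lift-event (minus s p) (_ , minus-part , _)     B⊆X = lift-boundary consumed s p minus-part B⊆X

  lift-events : {A : List (Ev Z₁)} {Bs : List (List (Ev Z₀))} →
                Pointwise (ProjEv f₁) A Bs → concat Bs ⊆ X → Σ (List (Ev Z₃)) (Pointwise (MapsEv α₁) A)
  lift-events []                        _ = [] , []
  lift-events {Bs = B ∷ _} (e↓B ∷ A↓Bs) ⊆X
    with lift-event _ e↓B (λ i → ⊆X (∈-++⁺ˡ i)) | lift-events A↓Bs (λ i → ⊆X (∈-++⁺ʳ B i))
  ... | e₃ , e↦e₃ | A₃ , A↦A₃ = e₃ ∷ A₃ , e↦e₃ ∷ A↦A₃

  lift-projection : {A : List (Ev Z₁)} → ProjEq f₁ A X → Σ (List (Ev Z₃)) (Pointwise (MapsEv α₁) A)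
  lift-projection (_ , A↓Bs , concat≋X) = lift-events A↓Bs (to concat≋X)

  A₃ : List (Ev Z₃)
  A₃ = proj₁ (lift-projection A₁↓X)

  A₁↦A₃ : ImgEq α₁ A₁ A₃
  A₁↦A₃ = A₃ , proj₂ (lift-projection A₁↓X) , ↔-refl

  -- The places of A₃ are the union of those of A₁ and A₂: along α₁ by
  -- injectivity, along α₂ since A₂ = f₂(X) and X is A₁ restricted to Z₀.
  places-union : (σ : Side) → Union (fS α₁) (fS α₂) (places σ A₁) (places σ A₂) (places σ A₃)
  places-union σ =
      (λ _ → image-places α₁ net₁ A₁↦A₃ σ ⟫ ↔-sym (∈-map-injective α₁-injective (places σ A₁)))
    , (λ b → image-places α₁ net₁ A₁↦A₃ σ
             ⟫ Pushout.pushout-restrict pushoutS (IsEmbedding.injS emb₁)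
                 (projection-places f₁ emb₁ A₁↓X σ) b
             ⟫ ↔-sym (image-places f₂ f₂-net X↦A₂ σ))
    where
    f₂-net : IsNetMorphism f₂
    f₂-net = IsOpenMorphism.isNetMorphism (IsEmbedding.isOpenMorphism emb₂)

lemma3p1 : {Λ : Set} {Z₀ Z₁ Z₂ Z₃ : OpenNet Λ}
           (f₁ : NetMap Z₀ Z₁) (f₂ : NetMap Z₀ Z₂)
           → IsEmbedding f₁ → IsEmbedding f₂ → Composable f₁ f₂
           → (α₁ : NetMap Z₁ Z₃) (α₂ : NetMap Z₂ Z₃)
           → IsComposition f₁ f₂ α₁ α₂
           → (u₁ v₁ : List (S Z₁)) (A₁ : List (Ev Z₁))
           → (u₂ v₂ : List (S Z₂)) (A₂ : List (Ev Z₂))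
           → Step Z₁ u₁ A₁ v₁
           → Step Z₂ u₂ A₂ v₂
           → RestrEq (fS f₁) u₁ (fS f₂) u₂
           → Σ (List (Ev Z₀)) (λ X → ProjEq f₁ A₁ X × ImgEq f₂ X A₂)
           → RestrEq (fS f₁) v₁ (fS f₂) v₂
             × Σ (List (Ev Z₃)) (λ A₃ → ImgEq α₁ A₁ A₃
                 × ((u₃ v₃ : List (S Z₃))
                    → IsUnion α₁ α₂ u₁ u₂ u₃
                    → IsUnion α₁ α₂ v₁ v₂ v₃
                    → Step Z₃ u₃ A₃ v₃))
lemma3p1 f₁ f₂ emb₁ emb₂ _ α₁ α₂ composition _ _ A₁ _ _ A₂ step₁ step₂ u-agree (_ , A₁↓X , X↦A₂) =
    step-restrict {A₁ = A₁} {A₂ = A₂} step₁ step₂ u-agree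
      (places-agree consumed) (places-agree produced)
  , A₃ , A₁↦A₃
  , λ _ _ u-union v-union →
      step-union {A₁ = A₁} {A₂ = A₂} {A₃ = A₃} jsurj step₁ step₂ u-union v-union
        (places-union consumed) (places-union produced)
  where
  open Composite emb₁ emb₂ composition A₁↓X X↦A₂
  open IsSetPushout (IsComposition.pushoutS composition) using (commute; jsurj)

  -- A₁ and A₂ consume and produce the same tokens on Z₀, both being
  -- restrictions of A₃.
  places-agree : (σ : Side) → RestrEq (fS f₁) (places σ A₁) (fS f₂) (places σ A₂)
  places-agree σ = union-restrict commute (places-union σ)
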